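{- There exists an absolute constant $C \in \mathbb{N}$ such that for every odd integer $n \in \mathbb{N}$ there exists a $C$-Lipschitz bijection $\psi \colon \{0,1\}^n \to \{0,1\}^n$ that is a mapping from ${\sf Majority}$ to ${\sf Dictator}$, i.e. ${\sf Majority}(z) = {\sf Dictator}(\psi(z))$ for every $z \in \{0,1\}^n$.
   Context: For $f,g \colon \{0,1\}^n \to \{0,1\}$, a mapping from $f$ to $g$ is a bijection $\psi \colon \{0,1\}^n \to \{0,1\}^n$ with $f(z) = g(\psi(z))$ for all $z$. ${\sf Majority}(x) = 1$ if $\sum_{i=1}^n x_i > n/2$ and $0$ otherwise; ${\sf Dictator}(x) = x_1$. A map $\phi$ is $C$-Lipschitz if ${\sf dist}(\phi(x),\phi(y)) \le C\,{\sf dist}(x,y)$ for all $x,y$, where ${\sf dist}$ is Hamming distance. -}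

module Defs where

open import Data.Bool using (Bool; true; false; _≟_)
open import Data.Nat using (ℕ; zero; suc; _+_; _*_; _<_; _≤_; _<ᵇ_)
open import Data.Vec using (Vec; []; _∷_; head)
open import Relation.Nullary.Decidable using (does)

-- The Boolean cube {0,1}^n, with false = 0 and true = 1.
Cube : ℕ → Set
Cube n = Vec Bool n

weight : ∀ {n} → Cube n → ℕ
weight []           = 0
weight (false ∷ xs) = weight xs
weight (true  ∷ xs) = suc (weight xs)

dist : ∀ {n} → Cube n → Cube n → ℕ
dist []       []       = 0
dist (x ∷ xs) (y ∷ ys) with does (x ≟ y)
... | true  = dist xs ys
... | false = suc (dist xs ys)

Majority : ∀ {n} → Cube n → Bool
Majority {n} x = n <ᵇ 2 * weight x

Dictator : ∀ {n} → Cube (suc n) → Bool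
Dictator x = head x

Lipschitz : ∀ {n} → ℕ → (Cube n → Cube n) → Set
Lipschitz {n} C φ = ∀ (x y : Cube n) → dist (φ x) (φ y) ≤ C * dist x y

module Submission where

-- Symmetric chains: scanning a word r from its last letter to its first, with 1
-- opening and 0 closing a bracket, the unmatched letters form a block 0…0 1…1.
-- Rewriting them with the matched pairs fixed sweeps out the chain of r, whose
-- member chainAt r a has a unmatched 1s (0 ≤ a ≤ len r).  So z ∷ r has
-- coordinates (z , rank r) ∈ Bool × [0 , len r]; interleaving them to
-- t = z + 2·rank r ∈ [0 , 2·len r + 1] and folding this segment in half gives
-- new coordinates (len r < t , min t (2·len r + 1 - t)), and ψ re-places z ∷ r
-- there.  For odd n, "t lies in the upper half" is exactly Majority, and a
-- single flipped letter moves every quantity involved by O(1).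

open import Defs
open import Data.Bool using (Bool; true; false; not)
open import Data.Nat
  using (ℕ; zero; suc; _*_; _+_; _∸_; _⊓_; _≤_; _<_; z≤n; s≤s; pred; ∣_-_∣; _<ᵇ_; ⌊_/2⌋)
open import Data.Nat.Properties
open import Data.Nat.Solver using (module +-*-Solver)
open import Data.Product using (Σ; _×_; _,_; proj₁; proj₂)
open import Data.Vec using ([]; _∷_)
open import Function.Consequences.Propositional
  using (inverseᵇ⇒bijective; strictlyInverseˡ⇒inverseˡ; strictlyInverseʳ⇒inverseʳ)
open import Function.Definitions using (Bijective)
open import Relation.Binary.PropositionalEquality
open import Relation.Nullary using (yes; no)

∣n-1+n∣≡1 : ∀ n → ∣ n - suc n ∣ ≡ 1
∣n-1+n∣≡1 zero    = refl
∣n-1+n∣≡1 (suc n) = ∣n-1+n∣≡1 n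

∣1+n-n∣≡1 : ∀ n → ∣ suc n - n ∣ ≡ 1
∣1+n-n∣≡1 n = trans (∣-∣-comm (suc n) n) (∣n-1+n∣≡1 n)

∣n-pred-n∣≤1 : ∀ n → ∣ n - pred n ∣ ≤ 1
∣n-pred-n∣≤1 zero    = z≤n
∣n-pred-n∣≤1 (suc n) = ≤-reflexive (∣1+n-n∣≡1 n)

∣2+n-n∣≡2 : ∀ n → ∣ suc (suc n) - n ∣ ≡ 2
∣2+n-n∣≡2 zero    = refl
∣2+n-n∣≡2 (suc n) = ∣2+n-n∣≡2 n

∣n-2+n∣≡2 : ∀ n → ∣ n - suc (suc n) ∣ ≡ 2
∣n-2+n∣≡2 n = trans (∣-∣-comm n (suc (suc n))) (∣2+n-n∣≡2 n)

∣1+m-n∣≤1+∣m-n∣ : ∀ m n → ∣ suc m - n ∣ ≤ suc ∣ m - n ∣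
∣1+m-n∣≤1+∣m-n∣ m n =
  ≤-trans (∣-∣-triangle (suc m) m n) (≤-reflexive (cong (_+ ∣ m - n ∣) (∣1+n-n∣≡1 m)))

∣pred-m-pred-n∣≤∣m-n∣ : ∀ m n → ∣ pred m - pred n ∣ ≤ ∣ m - n ∣
∣pred-m-pred-n∣≤∣m-n∣ zero    zero    = ≤-refl
∣pred-m-pred-n∣≤∣m-n∣ zero    (suc n) = n≤1+n n
∣pred-m-pred-n∣≤∣m-n∣ (suc m) zero    = ≤-trans (≤-reflexive (∣-∣-identityʳ m)) (n≤1+n m)
∣pred-m-pred-n∣≤∣m-n∣ (suc m) (suc n) = ≤-refl

∣-∣-perturb : ∀ x x' y y' → ∣ x - x' ∣ ≤ 1 → ∣ y - y' ∣ ≤ 1 → ∣ x' - y' ∣ ≤ 2 + ∣ x - y ∣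
∣-∣-perturb x x' y y' x≈x' y≈y' = begin
  ∣ x' - y' ∣                          ≤⟨ ∣-∣-triangle x' x y' ⟩
  ∣ x' - x ∣ + ∣ x - y' ∣              ≤⟨ +-monoʳ-≤ ∣ x' - x ∣ (∣-∣-triangle x y y') ⟩
  ∣ x' - x ∣ + (∣ x - y ∣ + ∣ y - y' ∣) ≤⟨ +-mono-≤ x'≈x (+-monoʳ-≤ ∣ x - y ∣ y≈y') ⟩
  1 + (∣ x - y ∣ + 1)                  ≡⟨ cong suc (+-comm ∣ x - y ∣ 1) ⟩
  2 + ∣ x - y ∣                        ∎
  where
  open ≤-Reasoning
  x'≈x : ∣ x' - x ∣ ≤ 1
  x'≈x = subst (_≤ 1) (∣-∣-comm x x') x≈x'

∣-∣-nonexpansive₂ : (_∙_ : ℕ → ℕ → ℕ) →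
  (∀ x x' y → ∣ x ∙ y - x' ∙ y ∣ ≤ ∣ x - x' ∣) →
  (∀ x y y' → ∣ x ∙ y - x ∙ y' ∣ ≤ ∣ y - y' ∣) →
  ∀ x y x' y' → ∣ x ∙ y - x' ∙ y' ∣ ≤ ∣ x - x' ∣ + ∣ y - y' ∣
∣-∣-nonexpansive₂ _∙_ left right x y x' y' = begin
  ∣ x ∙ y - x' ∙ y' ∣                      ≤⟨ ∣-∣-triangle (x ∙ y) (x' ∙ y) (x' ∙ y') ⟩
  ∣ x ∙ y - x' ∙ y ∣ + ∣ x' ∙ y - x' ∙ y' ∣ ≤⟨ +-mono-≤ (left x x' y) (right x' y y') ⟩
  ∣ x - x' ∣ + ∣ y - y' ∣                  ∎
  where open ≤-Reasoning

∣-∣-+ : ∀ x y x' y' → ∣ x + y - (x' + y') ∣ ≤ ∣ x - x' ∣ + ∣ y - y' ∣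
∣-∣-+ = ∣-∣-nonexpansive₂ _+_ left (λ x y y' → ≤-reflexive (∣m+n-m+o∣≡∣n-o∣ x y y'))
  where
  left : ∀ x x' y → ∣ x + y - (x' + y) ∣ ≤ ∣ x - x' ∣
  left x x' y = ≤-reflexive (trans (cong₂ ∣_-_∣ (+-comm x y) (+-comm x' y)) (∣m+n-m+o∣≡∣n-o∣ y x x'))

∣-∣-⊓ʳ : ∀ x y y' → ∣ x ⊓ y - x ⊓ y' ∣ ≤ ∣ y - y' ∣
∣-∣-⊓ʳ zero    y       y'       = z≤n
∣-∣-⊓ʳ (suc x) zero    zero     = z≤n
∣-∣-⊓ʳ (suc x) zero    (suc y') = s≤s (m⊓n≤n x y')
∣-∣-⊓ʳ (suc x) (suc y) zero     = s≤s (m⊓n≤n x y)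
∣-∣-⊓ʳ (suc x) (suc y) (suc y') = ∣-∣-⊓ʳ x y y'

∣-∣-⊓ : ∀ x y x' y' → ∣ x ⊓ y - x' ⊓ y' ∣ ≤ ∣ x - x' ∣ + ∣ y - y' ∣
∣-∣-⊓ = ∣-∣-nonexpansive₂ _⊓_ left ∣-∣-⊓ʳ
  where
  left : ∀ x x' y → ∣ x ⊓ y - x' ⊓ y ∣ ≤ ∣ x - x' ∣
  left x x' y = subst (_≤ ∣ x - x' ∣) (cong₂ ∣_-_∣ (⊓-comm y x) (⊓-comm y x')) (∣-∣-⊓ʳ y x x')

∣-∣-∸ˡ : ∀ x x' y → ∣ x ∸ y - (x' ∸ y) ∣ ≤ ∣ x - x' ∣
∣-∣-∸ˡ x       x'       zero    = ≤-refl
∣-∣-∸ˡ zero    zero     (suc y) = z≤n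
∣-∣-∸ˡ zero    (suc x') (suc y) = ≤-trans (m∸n≤m x' y) (n≤1+n x')
∣-∣-∸ˡ (suc x) zero     (suc y) =
  ≤-trans (≤-reflexive (∣-∣-identityʳ (x ∸ y))) (≤-trans (m∸n≤m x y) (n≤1+n x))
∣-∣-∸ˡ (suc x) (suc x') (suc y) = ∣-∣-∸ˡ x x' y

∣x-x∸y∣≤y : ∀ x y → ∣ x - (x ∸ y) ∣ ≤ y
∣x-x∸y∣≤y x       zero    = ≤-reflexive (∣n-n∣≡0 x)
∣x-x∸y∣≤y zero    (suc y) = z≤n
∣x-x∸y∣≤y (suc x) (suc y) = ≤-trans (∣1+m-n∣≤1+∣m-n∣ x (x ∸ y)) (s≤s (∣x-x∸y∣≤y x y))

∣-∣-∸ʳ : ∀ x y y' → ∣ x ∸ y - (x ∸ y') ∣ ≤ ∣ y - y' ∣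
∣-∣-∸ʳ zero    y       y'       = ≤-trans (≤-reflexive (cong₂ ∣_-_∣ (0∸n≡0 y) (0∸n≡0 y'))) z≤n
∣-∣-∸ʳ (suc x) zero    zero     = ≤-reflexive (∣n-n∣≡0 x)
∣-∣-∸ʳ (suc x) zero    (suc y') = ≤-trans (∣1+m-n∣≤1+∣m-n∣ x (x ∸ y')) (s≤s (∣x-x∸y∣≤y x y'))
∣-∣-∸ʳ (suc x) (suc y) zero     =
  subst (_≤ suc y) (∣-∣-comm (suc x) (x ∸ y)) (≤-trans (∣1+m-n∣≤1+∣m-n∣ x (x ∸ y)) (s≤s (∣x-x∸y∣≤y x y)))
∣-∣-∸ʳ (suc x) (suc y) (suc y') = ∣-∣-∸ʳ x y y'

∣-∣-∸ : ∀ x y x' y' → ∣ x ∸ y - (x' ∸ y') ∣ ≤ ∣ x - x' ∣ + ∣ y - y' ∣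
∣-∣-∸ = ∣-∣-nonexpansive₂ _∸_ ∣-∣-∸ˡ ∣-∣-∸ʳ

-- Hamming geometry of the cube

dist-refl : ∀ {n} (x : Cube n) → dist x x ≡ 0
dist-refl []          = refl
dist-refl (true ∷ x)  = dist-refl x
dist-refl (false ∷ x) = dist-refl x

dist≡0⇒≡ : ∀ {n} (x y : Cube n) → dist x y ≡ 0 → x ≡ y
dist≡0⇒≡ []          []          _ = refl
dist≡0⇒≡ (true ∷ x)  (true ∷ y)  e = cong (true ∷_) (dist≡0⇒≡ x y e)
dist≡0⇒≡ (false ∷ x) (false ∷ y) e = cong (false ∷_) (dist≡0⇒≡ x y e)
dist≡0⇒≡ (true ∷ x)  (false ∷ y) ()
dist≡0⇒≡ (false ∷ x) (true ∷ y)  ()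

dist-∷ : ∀ {n} b c (xs ys : Cube n) → dist (b ∷ xs) (c ∷ ys) ≤ suc (dist xs ys)
dist-∷ true  true  xs ys = n≤1+n _
dist-∷ false false xs ys = n≤1+n _
dist-∷ true  false xs ys = ≤-refl
dist-∷ false true  xs ys = ≤-refl

dist-triangle : ∀ {n} (x y z : Cube n) → dist x z ≤ dist x y + dist y z
dist-triangle [] [] [] = z≤n
dist-triangle (true ∷ x)  (true ∷ y)  (true ∷ z)  = dist-triangle x y z
dist-triangle (false ∷ x) (false ∷ y) (false ∷ z) = dist-triangle x y z
dist-triangle (true ∷ x)  (true ∷ y)  (false ∷ z) =
  ≤-trans (s≤s (dist-triangle x y z)) (≤-reflexive (sym (+-suc _ _)))
dist-triangle (false ∷ x) (false ∷ y) (true ∷ z)  =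
  ≤-trans (s≤s (dist-triangle x y z)) (≤-reflexive (sym (+-suc _ _)))
dist-triangle (true ∷ x)  (false ∷ y) (true ∷ z)  =
  ≤-trans (dist-triangle x y z) (≤-trans (m≤n+m _ 2) (≤-reflexive (cong suc (sym (+-suc _ _)))))
dist-triangle (false ∷ x) (true ∷ y)  (false ∷ z) =
  ≤-trans (dist-triangle x y z) (≤-trans (m≤n+m _ 2) (≤-reflexive (cong suc (sym (+-suc _ _)))))
dist-triangle (true ∷ x)  (false ∷ y) (false ∷ z) = s≤s (dist-triangle x y z)
dist-triangle (false ∷ x) (true ∷ y)  (true ∷ z)  = s≤s (dist-triangle x y z)

data Adjacent : ∀ {n} → Cube n → Cube n → Set where
  here  : ∀ {n x} {xs : Cube n} → Adjacent (x ∷ xs) (not x ∷ xs)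
  there : ∀ {n x} {xs ys : Cube n} → Adjacent xs ys → Adjacent (x ∷ xs) (x ∷ ys)

adjacent-step : ∀ {n} (x y : Cube n) d → dist x y ≡ suc d →
  Σ (Cube n) λ x' → Adjacent x x' × dist x' y ≡ d
adjacent-step [] [] d ()
adjacent-step (true ∷ x)  (true ∷ y)  d e with adjacent-step x y d e
... | x' , adj , e' = true ∷ x' , there adj , e'
adjacent-step (false ∷ x) (false ∷ y) d e with adjacent-step x y d e
... | x' , adj , e' = false ∷ x' , there adj , e'
adjacent-step (true ∷ x)  (false ∷ y) d e = false ∷ x , here , suc-injective e
adjacent-step (false ∷ x) (true ∷ y)  d e = true ∷ x , here , suc-injective e

-- A self-map of the cube moving adjacent words at most C apart is C-Lipschitz:
-- walk along a shortest path and use the triangle inequality.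
adjacent⇒lipschitz : ∀ {n} C (φ : Cube n → Cube n) →
  (∀ {x y} → Adjacent x y → dist (φ x) (φ y) ≤ C) → Lipschitz C φ
adjacent⇒lipschitz C φ step x y = along (dist x y) x y refl
  where
  along : ∀ d x y → dist x y ≡ d → dist (φ x) (φ y) ≤ C * d
  along zero x y e rewrite dist≡0⇒≡ x y e | dist-refl (φ y) = z≤n
  along (suc d) x y e with adjacent-step x y d e
  ... | x' , adj , e' = begin
    dist (φ x) (φ y)                   ≤⟨ dist-triangle (φ x) (φ x') (φ y) ⟩
    dist (φ x) (φ x') + dist (φ x') (φ y) ≤⟨ +-mono-≤ (step adj) (along d x' y e') ⟩
    C + C * d                          ≡⟨ *-suc C d ⟨
    C * suc d                          ∎
    where open ≤-Reasoning

-- Symmetric chains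
--
-- Scan a word from its last letter to its first; a 1 opens a bracket and a 0
-- closes the most recent open one, if any.  rank r counts the unmatched 1s,
-- len r all unmatched letters and pairs r the matched pairs.

rank : ∀ {n} → Cube n → ℕ
rank []          = 0
rank (true ∷ r)  = suc (rank r)
rank (false ∷ r) = pred (rank r)

-- A leading 0 is unmatched exactly when the rest has no unmatched 1.
lenAfter0 : ℕ → ℕ → ℕ
lenAfter0 zero    l = suc l
lenAfter0 (suc _) l = pred l

len : ∀ {n} → Cube n → ℕ
len []          = 0
len (true ∷ r)  = suc (len r)
len (false ∷ r) = lenAfter0 (rank r) (len r)

pairsAfter0 : ℕ → ℕ → ℕ
pairsAfter0 zero    k = k
pairsAfter0 (suc _) k = suc k

pairs : ∀ {n} → Cube n → ℕ
pairs []          = 0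
pairs (true ∷ r)  = pairs r
pairs (false ∷ r) = pairsAfter0 (rank r) (pairs r)

freeBit : ∀ {n} → (ℕ → Cube n) → ℕ → Cube (suc n)
freeBit g zero    = false ∷ g zero
freeBit g (suc a) = true ∷ g a

-- A leading 1, or a leading 0 facing no unmatched 1, is free; a leading 0 that
-- closes a bracket is kept and needs one more unmatched 1 in the rest.
chainStep : ∀ {n} → Bool → ℕ → (ℕ → Cube n) → ℕ → Cube (suc n)
chainStep true  _       g a = freeBit g a
chainStep false zero    g a = freeBit g a
chainStep false (suc _) g a = false ∷ g (suc a)

-- chainAt r a: the word with the matched pairs of r and a unmatched 1s.
chainAt : ∀ {n} → Cube n → ℕ → Cube n
chainAt []      a = []
chainAt (x ∷ r) a = chainStep x (rank r) (chainAt r) a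

rank≤len : ∀ {n} (r : Cube n) → rank r ≤ len r
rank≤len []          = z≤n
rank≤len (true ∷ r)  = s≤s (rank≤len r)
rank≤len (false ∷ r) with rank r | rank≤len r
... | zero  | _   = z≤n
... | suc k | k<l = pred-mono-≤ k<l

≤pred⇒< : ∀ {a l} → 0 < l → a ≤ pred l → suc a ≤ l
≤pred⇒< {l = suc l} _ a≤l = s≤s a≤l

-- Below a closing 0 the rest keeps an unmatched 1, so its chain is one longer.
closing-bound : ∀ {n a k} (r : Cube n) → rank r ≡ suc k → a ≤ pred (len r) → suc a ≤ len r
closing-bound r e a≤ = ≤pred⇒< (≤-trans (≤-trans (s≤s z≤n) (≤-reflexive (sym e))) (rank≤len r)) a≤

rank-chainAt : ∀ {n} (r : Cube n) a → a ≤ len r → rank (chainAt r a) ≡ a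
rank-chainAt []          zero    _       = refl
rank-chainAt (true ∷ r)  zero    _       = cong pred (rank-chainAt r 0 z≤n)
rank-chainAt (true ∷ r)  (suc a) (s≤s h) = cong suc (rank-chainAt r a h)
rank-chainAt (false ∷ r) a       h with rank r in e
rank-chainAt (false ∷ r) zero    _       | zero  = cong pred (rank-chainAt r 0 z≤n)
rank-chainAt (false ∷ r) (suc a) (s≤s h) | zero  = cong suc (rank-chainAt r a h)
... | suc k = cong pred (rank-chainAt r (suc a) (closing-bound r e h))

len-chainAt : ∀ {n} (r : Cube n) a → a ≤ len r → len (chainAt r a) ≡ len r
len-chainAt []          zero    _ = refl
len-chainAt (true ∷ r)  zero    _
  rewrite rank-chainAt r 0 z≤n | len-chainAt r 0 z≤n = refl
len-chainAt (true ∷ r)  (suc a) (s≤s h) = cong suc (len-chainAt r a h)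
len-chainAt (false ∷ r) a h with rank r in e
len-chainAt (false ∷ r) zero    _       | zero
  rewrite rank-chainAt r 0 z≤n | len-chainAt r 0 z≤n = refl
len-chainAt (false ∷ r) (suc a) (s≤s h) | zero  = cong suc (len-chainAt r a h)
... | suc k
  rewrite rank-chainAt r (suc a) (closing-bound r e h)
        | len-chainAt r (suc a) (closing-bound r e h) = refl

chainAt-rank : ∀ {n} (r : Cube n) → chainAt r (rank r) ≡ r
chainAt-rank []          = refl
chainAt-rank (true ∷ r)  = cong (true ∷_) (chainAt-rank r)
chainAt-rank (false ∷ r) with rank r in e
... | zero  = cong (false ∷_) (trans (cong (chainAt r) (sym e)) (chainAt-rank r))
... | suc k = cong (false ∷_) (trans (cong (chainAt r) (sym e)) (chainAt-rank r))

chainAt-chainAt : ∀ {n} (r : Cube n) a b → a ≤ len r → chainAt (chainAt r a) b ≡ chainAt r b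
chainAt-chainAt []          zero    b       _ = refl
chainAt-chainAt (true ∷ r)  zero    zero    _
  rewrite rank-chainAt r 0 z≤n = cong (false ∷_) (chainAt-chainAt r 0 0 z≤n)
chainAt-chainAt (true ∷ r)  zero    (suc b) _
  rewrite rank-chainAt r 0 z≤n = cong (true ∷_) (chainAt-chainAt r 0 b z≤n)
chainAt-chainAt (true ∷ r)  (suc a) zero    (s≤s h) = cong (false ∷_) (chainAt-chainAt r a 0 h)
chainAt-chainAt (true ∷ r)  (suc a) (suc b) (s≤s h) = cong (true ∷_) (chainAt-chainAt r a b h)
chainAt-chainAt (false ∷ r) a b h with rank r in e
chainAt-chainAt (false ∷ r) zero    zero    _       | zero
  rewrite rank-chainAt r 0 z≤n = cong (false ∷_) (chainAt-chainAt r 0 0 z≤n)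
chainAt-chainAt (false ∷ r) zero    (suc b) _       | zero
  rewrite rank-chainAt r 0 z≤n = cong (true ∷_) (chainAt-chainAt r 0 b z≤n)
chainAt-chainAt (false ∷ r) (suc a) zero    (s≤s h) | zero = cong (false ∷_) (chainAt-chainAt r a 0 h)
chainAt-chainAt (false ∷ r) (suc a) (suc b) (s≤s h) | zero = cong (true ∷_) (chainAt-chainAt r a b h)
... | suc k rewrite rank-chainAt r (suc a) (closing-bound r e h) =
  cong (false ∷_) (chainAt-chainAt r (suc a) (suc b) (closing-bound r e h))

weight≡pairs+rank : ∀ {n} (r : Cube n) → weight r ≡ pairs r + rank r
weight≡pairs+rank []          = refl
weight≡pairs+rank (true ∷ r)  = trans (cong suc (weight≡pairs+rank r)) (sym (+-suc (pairs r) (rank r)))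
weight≡pairs+rank (false ∷ r) with rank r | weight≡pairs+rank r
... | zero  | e = e
... | suc k | e = trans e (+-suc (pairs r) k)

length≡pairs+len : ∀ {n} (r : Cube n) → n ≡ (pairs r + pairs r) + len r
length≡pairs+len []          = refl
length≡pairs+len (true ∷ r)  = trans (cong suc (length≡pairs+len r)) (sym (+-suc (pairs r + pairs r) (len r)))
length≡pairs+len (false ∷ r) with rank r | rank≤len r | length≡pairs+len r
... | zero  | _ | e = trans (cong suc e) (sym (+-suc (pairs r + pairs r) (len r)))
... | suc k | h | e with len r | h
... | suc l | _ = trans (cong suc e)
  (cong suc (trans (+-suc (pairs r + pairs r) l) (cong (_+ l) (sym (+-suc (pairs r) (pairs r))))))

-- Distances along and across chains

freeBit-dist : ∀ {n} (g h : ℕ → Cube n) K → (∀ b b' → dist (g b) (h b') ≤ ∣ b - b' ∣ + K) →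
  ∀ a a' → dist (freeBit g a) (freeBit h a') ≤ ∣ a - a' ∣ + K
freeBit-dist g h K H zero    zero     = H 0 0
freeBit-dist g h K H zero    (suc a') = s≤s (H 0 a')
freeBit-dist g h K H (suc a) zero     = s≤s (subst (λ d → dist (g a) (h 0) ≤ d + K) (∣-∣-identityʳ a) (H a 0))
freeBit-dist g h K H (suc a) (suc a') = H a a'

freeBit-closing-dist : ∀ {n} (g h : ℕ → Cube n) K → (∀ b b' → dist (g b) (h b') ≤ ∣ b - b' ∣ + K) →
  ∀ a a' → dist (freeBit g a) (false ∷ h (suc a')) ≤ 3 + (∣ a - a' ∣ + K)
freeBit-closing-dist g h K H zero    a' = ≤-trans (H 0 (suc a')) (m≤n+m _ 2)
freeBit-closing-dist g h K H (suc a) a' =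
  s≤s (≤-trans (H a (suc a')) (+-monoˡ-≤ K (∣-∣-perturb (suc a) a a' (suc a') (≤-reflexive (∣1+n-n∣≡1 a)) (≤-reflexive (∣n-1+n∣≡1 a')))))

closing-freeBit-dist : ∀ {n} (g h : ℕ → Cube n) K → (∀ b b' → dist (g b) (h b') ≤ ∣ b - b' ∣ + K) →
  ∀ a a' → dist (false ∷ g (suc a)) (freeBit h a') ≤ 3 + (∣ a - a' ∣ + K)
closing-freeBit-dist g h K H a zero rewrite ∣-∣-identityʳ a = ≤-trans (H (suc a) 0) (m≤n+m _ 2)
closing-freeBit-dist g h K H a (suc a') =
  s≤s (≤-trans (H (suc a) a') (+-monoˡ-≤ K (∣-∣-perturb a (suc a) (suc a') a' (≤-reflexive (∣n-1+n∣≡1 a)) (≤-reflexive (∣1+n-n∣≡1 a')))))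

chainAt-dist : ∀ {n} (r : Cube n) a a' → dist (chainAt r a) (chainAt r a') ≤ ∣ a - a' ∣ + 0
chainAt-dist []          a a' = z≤n
chainAt-dist (true ∷ r)       = freeBit-dist (chainAt r) (chainAt r) 0 (chainAt-dist r)
chainAt-dist (false ∷ r) a a' with rank r
... | zero  = freeBit-dist (chainAt r) (chainAt r) 0 (chainAt-dist r) a a'
... | suc k = chainAt-dist r (suc a) (suc a')

rank-adjacent : ∀ {n} {r r' : Cube n} → Adjacent r r' → ∣ rank r - rank r' ∣ ≤ 2
rank-adjacent (here {x = true} {xs = t}) with rank t
... | zero  = s≤s z≤n
... | suc k = ≤-reflexive (∣2+n-n∣≡2 k)
rank-adjacent (here {x = false} {xs = t}) with rank t
... | zero  = s≤s z≤n
... | suc k = ≤-reflexive (∣n-2+n∣≡2 k)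
rank-adjacent (there {x = true} adj) = rank-adjacent adj
rank-adjacent (there {x = false} {xs = s} {ys = s'} adj) =
  ≤-trans (∣pred-m-pred-n∣≤∣m-n∣ (rank s) (rank s')) (rank-adjacent adj)

-- Scanning further, the rank gap d of two adjacent words never grows, and each
-- letter at which it shrinks costs a bounded amount; the potential c * (3 ∸ d)
-- pays for those letters.
potential-step : ∀ c k → suc k ≤ 2 → c + c * (3 ∸ suc k) ≤ c * (3 ∸ k)
potential-step c zero          _ = ≤-reflexive (sym (*-suc c 2))
potential-step c (suc zero)    _ = ≤-reflexive (sym (*-suc c 1))
potential-step c (suc (suc k)) (s≤s (s≤s ()))

absorb3 : ∀ x B B' → 3 + B ≤ B' → 3 + (x + B) ≤ x + B'
absorb3 x B B' h = ≤-trans (≤-reflexive (+-comm-middle x B)) (+-monoʳ-≤ x h)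
  where
  +-comm-middle : ∀ x B → 3 + (x + B) ≡ x + (3 + B)
  +-comm-middle x B = trans (sym (+-assoc 3 x B)) (trans (cong (_+ B) (+-comm 3 x)) (+-assoc x 3 B))

len-adjacent : ∀ {n} {r r' : Cube n} → Adjacent r r' → ∣ len r - len r' ∣ ≤ 2 * (3 ∸ ∣ rank r - rank r' ∣)
len-adjacent (here {x = true} {xs = t}) with rank t
... | zero rewrite ∣n-n∣≡0 (len t) = z≤n
... | suc k rewrite ∣2+n-n∣≡2 k =
  ≤-trans (∣-∣-perturb (len t) _ (len t) _ (≤-reflexive (∣n-1+n∣≡1 (len t))) (∣n-pred-n∣≤1 (len t))) (≤-reflexive (cong (2 +_) (∣n-n∣≡0 (len t))))
len-adjacent (here {x = false} {xs = t}) with rank t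
... | zero rewrite ∣n-n∣≡0 (len t) = z≤n
... | suc k rewrite ∣n-2+n∣≡2 k =
  ≤-trans (∣-∣-perturb (len t) _ (len t) _ (∣n-pred-n∣≤1 (len t)) (≤-reflexive (∣n-1+n∣≡1 (len t)))) (≤-reflexive (cong (2 +_) (∣n-n∣≡0 (len t))))
len-adjacent (there {x = true} adj) = len-adjacent adj
len-adjacent (there {x = false} {xs = s} {ys = s'} adj) with rank s | rank s' | len-adjacent adj | rank-adjacent adj
... | zero  | zero   | H | _ = H
... | suc k | suc k' | H | _ = ≤-trans (∣pred-m-pred-n∣≤∣m-n∣ (len s) (len s')) H
... | zero  | suc k  | H | d =
  ≤-trans (∣-∣-perturb (len s) _ (len s') _ (≤-reflexive (∣n-1+n∣≡1 (len s))) (∣n-pred-n∣≤1 (len s'))) (≤-trans (+-monoʳ-≤ 2 H) (potential-step 2 k d))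
... | suc k | zero   | H | d rewrite ∣-∣-identityʳ k =
  ≤-trans (∣-∣-perturb (len s) _ (len s') _ (∣n-pred-n∣≤1 (len s)) (≤-reflexive (∣n-1+n∣≡1 (len s')))) (≤-trans (+-monoʳ-≤ 2 H) (potential-step 2 k d))

chainAt-adjacent : ∀ {n} {r r' : Cube n} → Adjacent r r' →
  ∀ a a' → dist (chainAt r a) (chainAt r' a') ≤ ∣ a - a' ∣ + 3 * (3 ∸ ∣ rank r - rank r' ∣)
chainAt-adjacent (here {x = true} {xs = t}) a a' with rank t
... | zero  = ≤-trans (freeBit-dist (chainAt t) (chainAt t) 0 (chainAt-dist t) a a') (+-monoʳ-≤ ∣ a - a' ∣ z≤n)
... | suc k rewrite ∣2+n-n∣≡2 k =
  ≤-trans (freeBit-closing-dist (chainAt t) (chainAt t) 0 (chainAt-dist t) a a') (absorb3 ∣ a - a' ∣ 0 3 ≤-refl)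
chainAt-adjacent (here {x = false} {xs = t}) a a' with rank t
... | zero  = ≤-trans (freeBit-dist (chainAt t) (chainAt t) 0 (chainAt-dist t) a a') (+-monoʳ-≤ ∣ a - a' ∣ z≤n)
... | suc k rewrite ∣n-2+n∣≡2 k =
  ≤-trans (closing-freeBit-dist (chainAt t) (chainAt t) 0 (chainAt-dist t) a a') (absorb3 ∣ a - a' ∣ 0 3 ≤-refl)
chainAt-adjacent (there {x = true} {xs = s} {ys = s'} adj) a a' =
  freeBit-dist (chainAt s) (chainAt s') _ (chainAt-adjacent adj) a a'
chainAt-adjacent (there {x = false} {xs = s} {ys = s'} adj) a a'
  with rank s | rank s' | chainAt-adjacent adj | rank-adjacent adj
... | zero  | zero   | H | _ = freeBit-dist (chainAt s) (chainAt s') _ H a a'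
... | suc k | suc k' | H | _ = H (suc a) (suc a')
... | zero  | suc k  | H | d =
  ≤-trans (freeBit-closing-dist (chainAt s) (chainAt s') _ H a a') (absorb3 ∣ a - a' ∣ _ _ (potential-step 3 k d))
... | suc k | zero   | H | d rewrite ∣-∣-identityʳ k =
  ≤-trans (closing-freeBit-dist (chainAt s) (chainAt s') _ H a a') (absorb3 ∣ a - a' ∣ _ _ (potential-step 3 k d))

-- Interleaving and folding: a bijection of Bool × [0 , M]

bit : Bool → ℕ
bit false = 0
bit true  = 1

isOdd : ℕ → Bool
isOdd zero          = false
isOdd (suc zero)    = true
isOdd (suc (suc n)) = isOdd n

interleave : Bool → ℕ → ℕ
interleave z U = bit z + (U + U)

interleave-suc : ∀ z U → interleave z (suc U) ≡ suc (suc (interleave z U))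
interleave-suc z U = trans (cong (bit z +_) (cong suc (+-suc U U)))
  (trans (+-suc (bit z) (suc (U + U))) (cong suc (+-suc (bit z) (U + U))))

⌊interleave/2⌋ : ∀ z U → ⌊ interleave z U /2⌋ ≡ U
⌊interleave/2⌋ false zero    = refl
⌊interleave/2⌋ true  zero    = refl
⌊interleave/2⌋ z     (suc U) rewrite interleave-suc z U = cong suc (⌊interleave/2⌋ z U)

isOdd-interleave : ∀ z U → isOdd (interleave z U) ≡ z
isOdd-interleave false zero    = refl
isOdd-interleave true  zero    = refl
isOdd-interleave z     (suc U) rewrite interleave-suc z U = isOdd-interleave z U

interleave-isOdd-⌊/2⌋ : ∀ t → interleave (isOdd t) ⌊ t /2⌋ ≡ t
interleave-isOdd-⌊/2⌋ zero          = refl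
interleave-isOdd-⌊/2⌋ (suc zero)    = refl
interleave-isOdd-⌊/2⌋ (suc (suc t)) =
  trans (interleave-suc (isOdd t) ⌊ t /2⌋) (cong (λ x → suc (suc x)) (interleave-isOdd-⌊/2⌋ t))

⌊/2⌋-bound : ∀ t M → t ≤ suc (M + M) → ⌊ t /2⌋ ≤ M
⌊/2⌋-bound zero          M       _               = z≤n
⌊/2⌋-bound (suc zero)    M       _               = z≤n
⌊/2⌋-bound (suc (suc t)) (suc M) (s≤s (s≤s t≤)) = s≤s (⌊/2⌋-bound t M (subst (t ≤_) (+-suc M M) t≤))

interleave-bound : ∀ z U M → U ≤ M → interleave z U ≤ suc (M + M)
interleave-bound z U M U≤M = +-mono-≤ (bit≤1 z) (+-mono-≤ U≤M U≤M)
  where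
  bit≤1 : ∀ z → bit z ≤ 1
  bit≤1 false = z≤n
  bit≤1 true  = ≤-refl

-- Folding [0 , 2M + 1] in half onto [0 , M]; unfold b undoes it on the lower
-- (b = false) or the upper (b = true) half.
fold : ℕ → ℕ → ℕ
fold t M = t ⊓ (suc (M + M) ∸ t)

unfold : Bool → ℕ → ℕ → ℕ
unfold false M A = A
unfold true  M A = suc (M + M) ∸ A

1+2M∸M≡1+M : ∀ M → suc (M + M) ∸ M ≡ suc M
1+2M∸M≡1+M M = m+n∸n≡m (suc M) M

1+2M∸1+M≡M : ∀ M → suc (M + M) ∸ suc M ≡ M
1+2M∸1+M≡M M = m+n∸n≡m M M

reflect-upper : ∀ M A → A ≤ M → M < suc (M + M) ∸ A
reflect-upper M A A≤M = ≤-trans (≤-reflexive (sym (1+2M∸M≡1+M M))) (∸-monoʳ-≤ (suc (M + M)) A≤M)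

fold-lower : ∀ t M → t ≤ M → fold t M ≡ t
fold-lower t M t≤M = m≤n⇒m⊓n≡m (≤-trans t≤M (<⇒≤ (reflect-upper M t t≤M)))

fold-upper : ∀ t M → M < t → fold t M ≡ suc (M + M) ∸ t
fold-upper t M M<t = m≥n⇒m⊓n≡n
  (≤-trans (∸-monoʳ-≤ (suc (M + M)) M<t) (≤-trans (≤-reflexive (1+2M∸1+M≡M M)) (<⇒≤ M<t)))

fold-bound : ∀ t M → fold t M ≤ M
fold-bound t M with t ≤? M
... | yes t≤M = ≤-trans (m⊓n≤m t _) t≤M
... | no  t≰M = ≤-trans (m⊓n≤n t _)
  (≤-trans (∸-monoʳ-≤ (suc (M + M)) (≰⇒> t≰M)) (≤-reflexive (1+2M∸1+M≡M M)))

unfold-bound : ∀ b M A → A ≤ M → unfold b M A ≤ suc (M + M)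
unfold-bound false M A A≤M = ≤-trans A≤M (≤-trans (m≤m+n M M) (n≤1+n _))
unfold-bound true  M A A≤M = m∸n≤m _ A

<ᵇ-true : ∀ M t → M < t → (M <ᵇ t) ≡ true
<ᵇ-true zero    (suc t) _       = refl
<ᵇ-true (suc M) (suc t) (s≤s h) = <ᵇ-true M t h

<ᵇ-false : ∀ M t → t ≤ M → (M <ᵇ t) ≡ false
<ᵇ-false M       zero    _       = refl
<ᵇ-false (suc M) (suc t) (s≤s h) = <ᵇ-false M t h

unfold-fold : ∀ t M → t ≤ suc (M + M) → unfold (M <ᵇ t) M (fold t M) ≡ t
unfold-fold t M t≤ with t ≤? M
... | yes t≤M rewrite <ᵇ-false M t t≤M = fold-lower t M t≤M
... | no  t≰M rewrite <ᵇ-true M t (≰⇒> t≰M) | fold-upper t M (≰⇒> t≰M) = m∸[m∸n]≡n t≤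

<ᵇ-unfold : ∀ b M A → A ≤ M → (M <ᵇ unfold b M A) ≡ b
<ᵇ-unfold false M A A≤M = <ᵇ-false M A A≤M
<ᵇ-unfold true  M A A≤M = <ᵇ-true M _ (reflect-upper M A A≤M)

fold-unfold : ∀ b M A → A ≤ M → fold (unfold b M A) M ≡ A
fold-unfold false M A A≤M = fold-lower A M A≤M
fold-unfold true  M A A≤M = trans (fold-upper _ M (reflect-upper M A A≤M))
  (m∸[m∸n]≡n (≤-trans A≤M (≤-trans (m≤m+n M M) (n≤1+n _))))

swap : ℕ → Bool × ℕ → Bool × ℕ
swap M (z , U) = ((M <ᵇ interleave z U) , fold (interleave z U) M)

unswap : ℕ → Bool × ℕ → Bool × ℕ
unswap M (b , A) = (isOdd (unfold b M A) , ⌊ unfold b M A /2⌋)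

swap-bound : ∀ M p → proj₂ p ≤ M → proj₂ (swap M p) ≤ M
swap-bound M (z , U) _ = fold-bound (interleave z U) M

unswap-bound : ∀ M p → proj₂ p ≤ M → proj₂ (unswap M p) ≤ M
unswap-bound M (b , A) A≤M = ⌊/2⌋-bound (unfold b M A) M (unfold-bound b M A A≤M)

unswap∘swap : ∀ M p → proj₂ p ≤ M → unswap M (swap M p) ≡ p
unswap∘swap M (z , U) U≤M
  rewrite unfold-fold (interleave z U) M (interleave-bound z U M U≤M)
        | isOdd-interleave z U | ⌊interleave/2⌋ z U = refl

swap∘unswap : ∀ M p → proj₂ p ≤ M → swap M (unswap M p) ≡ p
swap∘unswap M (b , A) A≤M
  rewrite interleave-isOdd-⌊/2⌋ (unfold b M A)
        | <ᵇ-unfold b M A A≤M | fold-unfold b M A A≤M = refl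

place : ∀ {n} → Cube n → Bool × ℕ → Cube (suc n)
place r p = proj₁ p ∷ chainAt r (proj₂ p)

reposition : ∀ {n} → (ℕ → Bool × ℕ → Bool × ℕ) → Cube (suc n) → Cube (suc n)
reposition σ (z ∷ r) = place r (σ (len r) (z , rank r))

-- Repositioning by mutually inverse, range-preserving maps is invertible,
-- since chains are preserved and words are determined by their coordinates.
reposition-inverse : ∀ {n} (σ τ : ℕ → Bool × ℕ → Bool × ℕ) →
  (∀ M p → proj₂ p ≤ M → proj₂ (σ M p) ≤ M) →
  (∀ M p → proj₂ p ≤ M → τ M (σ M p) ≡ p) →
  (w : Cube (suc n)) → reposition τ (reposition σ w) ≡ w
reposition-inverse σ τ σ-bound τ∘σ (z ∷ r) = begin
  place r' (τ (len r') (b , rank r'))      ≡⟨ cong₂ (λ M a → place r' (τ M (b , a))) (len-chainAt r A A≤) (rank-chainAt r A A≤) ⟩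
  place r' (τ (len r) (σ (len r) (z , rank r))) ≡⟨ cong (place r') (τ∘σ (len r) (z , rank r) (rank≤len r)) ⟩
  z ∷ chainAt r' (rank r)                  ≡⟨ cong (z ∷_) (chainAt-chainAt r A (rank r) A≤) ⟩
  z ∷ chainAt r (rank r)                   ≡⟨ cong (z ∷_) (chainAt-rank r) ⟩
  z ∷ r                                    ∎
  where
  open ≡-Reasoning
  b : Bool
  b = proj₁ (σ (len r) (z , rank r))
  A : ℕ
  A = proj₂ (σ (len r) (z , rank r))
  A≤ : A ≤ len r
  A≤ = σ-bound (len r) (z , rank r) (rank≤len r)
  r' : Cube _
  r' = chainAt r A

ψ : ∀ {n} → Cube (suc n) → Cube (suc n)
ψ = reposition swap

φ : ∀ {n} → Cube (suc n) → Cube (suc n)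
φ = reposition unswap

ψ-bijective : ∀ {n} → Bijective _≡_ _≡_ (ψ {n})
ψ-bijective = inverseᵇ⇒bijective
  ( strictlyInverseˡ⇒inverseˡ ψ (reposition-inverse unswap swap unswap-bound swap∘unswap)
  , strictlyInverseʳ⇒inverseʳ ψ (reposition-inverse swap unswap swap-bound unswap∘swap))

<ᵇ-cancelˡ-+ : ∀ c x y → (c + x <ᵇ c + y) ≡ (x <ᵇ y)
<ᵇ-cancelˡ-+ zero    x y = refl
<ᵇ-cancelˡ-+ (suc c) x y = <ᵇ-cancelˡ-+ c x y

odd<ᵇeven : ∀ s U → (suc (s + s) <ᵇ U + U) ≡ (s + s <ᵇ U + U)
odd<ᵇeven s       zero    = refl
odd<ᵇeven zero    (suc U) rewrite +-suc U U = refl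
odd<ᵇeven (suc s) (suc U) rewrite +-suc s s | +-suc U U = odd<ᵇeven s U

-- With n = 2(P + s) + 1 and weight z + P + U, Majority compares 2s with z + 2U.
majority-arith : ∀ z P U s →
  (suc (2 * (P + s)) <ᵇ 2 * (bit z + (P + U))) ≡ (s + s <ᵇ interleave z U)
majority-arith z P U s = begin
  suc (2 * (P + s)) <ᵇ 2 * (bit z + (P + U))                  ≡⟨ cong₂ _<ᵇ_ n≡ 2w≡ ⟩
  (P + P) + suc (s + s) <ᵇ (P + P) + (bit z + bit z + (U + U)) ≡⟨ <ᵇ-cancelˡ-+ (P + P) _ _ ⟩
  suc (s + s) <ᵇ bit z + bit z + (U + U)                      ≡⟨ odd<ᵇ z ⟩
  s + s <ᵇ interleave z U                                     ∎
  where
  open ≡-Reasoning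
  open +-*-Solver using (solve; _:+_; _:*_; _:=_; con)
  n≡ : suc (2 * (P + s)) ≡ (P + P) + suc (s + s)
  n≡ = solve 2 (λ P s → con 1 :+ con 2 :* (P :+ s) := (P :+ P) :+ (con 1 :+ (s :+ s))) refl P s
  2w≡ : 2 * (bit z + (P + U)) ≡ (P + P) + (bit z + bit z + (U + U))
  2w≡ = solve 3 (λ b P U → con 2 :* (b :+ (P :+ U)) := (P :+ P) :+ ((b :+ b) :+ (U :+ U))) refl (bit z) P U
  odd<ᵇ : ∀ z → (suc (s + s) <ᵇ bit z + bit z + (U + U)) ≡ (s + s <ᵇ interleave z U)
  odd<ᵇ false = odd<ᵇeven s U
  odd<ᵇ true  = refl

even-split : ∀ k P M → k + k ≡ (P + P) + M → Σ ℕ λ s → (M ≡ s + s) × (k ≡ P + s)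
even-split k       zero    M e = k , sym e , refl
even-split zero    (suc P) M ()
even-split (suc k) (suc P) M e with even-split k P M (suc-injective (suc-injective
  (trans (sym (cong suc (+-suc k k))) (trans e (cong suc (cong (_+ M) (+-suc P P)))))))
... | s , M≡s+s , k≡P+s = s , M≡s+s , cong suc k≡P+s

weight-∷ : ∀ {n} z (r : Cube n) → weight (z ∷ r) ≡ bit z + weight r
weight-∷ false r = refl
weight-∷ true  r = refl

majority-ψ : ∀ k (w : Cube (suc (2 * k))) → Majority w ≡ Dictator (ψ w)
majority-ψ k (z ∷ r)
  with even-split k (pairs r) (len r) (trans (cong (k +_) (sym (+-identityʳ k))) (length≡pairs+len r))
... | s , len≡s+s , k≡P+s = begin
  suc (2 * k) <ᵇ 2 * weight (z ∷ r)                ≡⟨ cong₂ (λ x y → suc (2 * x) <ᵇ 2 * y) k≡P+s weight≡ ⟩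
  suc (2 * (pairs r + s)) <ᵇ 2 * (bit z + (pairs r + rank r)) ≡⟨ majority-arith z (pairs r) (rank r) s ⟩
  s + s <ᵇ interleave z (rank r)                   ≡⟨ cong (_<ᵇ interleave z (rank r)) len≡s+s ⟨
  len r <ᵇ interleave z (rank r)                   ∎
  where
  open ≡-Reasoning
  weight≡ : weight (z ∷ r) ≡ bit z + (pairs r + rank r)
  weight≡ = trans (weight-∷ z r) (cong (bit z +_) (weight≡pairs+rank r))

interleave-dist : ∀ z U z' U' → ∣ interleave z U - interleave z' U' ∣ ≤ ∣ bit z - bit z' ∣ + (∣ U - U' ∣ + ∣ U - U' ∣)
interleave-dist z U z' U' =
  ≤-trans (∣-∣-+ (bit z) (U + U) (bit z') (U' + U')) (+-monoʳ-≤ ∣ bit z - bit z' ∣ (∣-∣-+ U U U' U'))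

fold-dist : ∀ t M t' M' → ∣ fold t M - fold t' M' ∣ ≤ ∣ t - t' ∣ + ((∣ M - M' ∣ + ∣ M - M' ∣) + ∣ t - t' ∣)
fold-dist t M t' M' = ≤-trans (∣-∣-⊓ t _ t' _) (+-monoʳ-≤ ∣ t - t' ∣
  (≤-trans (∣-∣-∸ (suc (M + M)) t (suc (M' + M')) t') (+-monoˡ-≤ ∣ t - t' ∣ (∣-∣-+ M M M' M'))))

swap-dist : ∀ M M' z z' U U' {δb δU δM} →
  ∣ bit z - bit z' ∣ ≤ δb → ∣ U - U' ∣ ≤ δU → ∣ M - M' ∣ ≤ δM →
  ∣ proj₂ (swap M (z , U)) - proj₂ (swap M' (z' , U')) ∣ ≤ (δb + (δU + δU)) + ((δM + δM) + (δb + (δU + δU)))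
swap-dist M M' z z' U U' {δb} {δU} hb hU hM =
  ≤-trans (fold-dist (interleave z U) M (interleave z' U') M') (+-mono-≤ ht (+-mono-≤ (+-mono-≤ hM hM) ht))
  where
  ht : ∣ interleave z U - interleave z' U' ∣ ≤ δb + (δU + δU)
  ht = ≤-trans (interleave-dist z U z' U') (+-mono-≤ hb (+-mono-≤ hU hU))

∣bit-flip∣≤1 : ∀ z → ∣ bit z - bit (not z) ∣ ≤ 1
∣bit-flip∣≤1 false = ≤-refl
∣bit-flip∣≤1 true  = ≤-refl

-- Flipping the first letter moves ψ by at most 3; flipping another letter
-- changes rank and len of the tail by at most 2 and 6, hence ψ by at most 30.
ψ-adjacent : ∀ {n} {w w' : Cube (suc n)} → Adjacent w w' → dist (ψ w) (ψ w') ≤ 30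
ψ-adjacent (here {x = z} {xs = r}) = ≤-trans (dist-∷ B B' (chainAt r A) (chainAt r A')) (s≤s (begin
  dist (chainAt r A) (chainAt r A') ≤⟨ chainAt-dist r A A' ⟩
  ∣ A - A' ∣ + 0                    ≤⟨ +-monoˡ-≤ 0 (swap-dist (len r) (len r) z (not z) (rank r) (rank r) (∣bit-flip∣≤1 z) (≤-reflexive (∣n-n∣≡0 (rank r))) (≤-reflexive (∣n-n∣≡0 (len r)))) ⟩
  2                                 ≤⟨ m≤m+n 2 27 ⟩
  29                                ∎))
  where
  open ≤-Reasoning
  B B' : Bool
  B  = proj₁ (swap (len r) (z , rank r))
  B' = proj₁ (swap (len r) (not z , rank r))
  A A' : ℕ
  A  = proj₂ (swap (len r) (z , rank r))
  A' = proj₂ (swap (len r) (not z , rank r))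
ψ-adjacent (there {x = z} {xs = r} {ys = r'} adj) = ≤-trans (dist-∷ B B' (chainAt r A) (chainAt r' A')) (s≤s (begin
  dist (chainAt r A) (chainAt r' A')                ≤⟨ chainAt-adjacent adj A A' ⟩
  ∣ A - A' ∣ + 3 * (3 ∸ ∣ rank r - rank r' ∣)       ≤⟨ +-mono-≤ ΔA≤20 (*-monoʳ-≤ 3 (m∸n≤m 3 ∣ rank r - rank r' ∣)) ⟩
  29                                                ∎))
  where
  open ≤-Reasoning
  B B' : Bool
  B  = proj₁ (swap (len r) (z , rank r))
  B' = proj₁ (swap (len r') (z , rank r'))
  A A' : ℕ
  A  = proj₂ (swap (len r) (z , rank r))
  A' = proj₂ (swap (len r') (z , rank r'))
  Δlen≤6 : ∣ len r - len r' ∣ ≤ 6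
  Δlen≤6 = ≤-trans (len-adjacent adj) (*-monoʳ-≤ 2 (m∸n≤m 3 ∣ rank r - rank r' ∣))
  ΔA≤20 : ∣ A - A' ∣ ≤ 20
  ΔA≤20 = swap-dist (len r) (len r') z z (rank r) (rank r') (≤-reflexive (∣n-n∣≡0 (bit z))) (rank-adjacent adj) Δlen≤6

theorem1 : Σ ℕ λ C → ∀ (k : ℕ) → Σ (Cube (suc (2 * k)) → Cube (suc (2 * k))) λ ψ → Bijective _≡_ _≡_ ψ × Lipschitz C ψ × (∀ (z : Cube (suc (2 * k))) → Majority z ≡ Dictator (ψ z))
theorem1 = 30 , λ k →
  ψ , ψ-bijective , adjacent⇒lipschitz 30 ψ ψ-adjacent , majority-ψ k
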